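{- Let $T,U,V$ be unlabelled binary trees. For an element $w$ of the sylvester monoid $\mathrm{sylv}$ with $\mathrm{Sh}(\mathrm{P}(w)) = T$, let $N(w)$ be the number of pairs $(s,t) \in \mathrm{sylv}\times\mathrm{sylv}$ with $st = w$, $\mathrm{Sh}(\mathrm{P}(s)) = U$ and $\mathrm{Sh}(\mathrm{P}(t)) = V$. Then $N(w)$ depends only on $T$, $U$ and $V$, and not on the content of $w$: if $w,w' \in \mathrm{sylv}$ both satisfy $\mathrm{Sh}(\mathrm{P}(w)) = \mathrm{Sh}(\mathrm{P}(w')) = T$, then $N(w) = N(w')$.
   Context: $\mathcal{A} = \{1,2,3,\ldots\}$ with the usual order; $\mathcal{A}^*$ the free monoid over $\mathcal{A}$. A right strict binary search tree is a labelled rooted binary tree where each node's label is $\ge$ all labels in its left subtree and $<$ all labels in its right subtree. $\mathrm{rtree}(a_1\cdots a_k)$ is obtained from the empty tree by inserting $a_k,\ldots,a_1$ in turn, where inserting $a$ creates a node labelled $a$ if the tree is empty and otherwise recurses into the left subtree if $a \le$ root label and into the right subtree otherwise. The sylvester congruence is $u \equiv_{\mathrm{sylv}} v$ iff $\mathrm{rtree}(u) = \mathrm{rtree}(v)$; it is a congruence and the sylvester monoid is $\mathrm{sylv} = \mathcal{A}^*/{\equiv_{\mathrm{sylv}}}$. For $s \in \mathrm{sylv}$, $\mathrm{P}(s)$ denotes $\mathrm{rtree}(u)$ for any word $u$ representing $s$. $\mathrm{Sh}(\cdot)$ denotes the shape, i.e. the underlying unlabelled rooted binary tree. -}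

module Defs where

open import Data.Nat using (ℕ; _≤?_)
open import Data.List using (List; []; _∷_; _++_; foldr)
open import Data.Fin using (Fin)
open import Data.Product using (_×_; _,_; Σ; ∃; proj₁; proj₂)
open import Relation.Nullary using (yes; no)
open import Relation.Binary.PropositionalEquality using (_≡_)

-- Letters: the alphabet 𝒜 = {1,2,3,...} with its usual order is represented by ℕ
-- (letter n ∈ ℕ stands for n+1 ∈ 𝒜); this is an order isomorphism.
Letter : Set
Letter = ℕ

Word : Set
Word = List Letter

data BTree : Set where
  leaf : BTree
  node : BTree → BTree → BTree

data LTree : Set where
  lf : LTree
  nd : LTree → Letter → LTree → LTree

insert : Letter → LTree → LTree
insert a lf = nd lf a lf
insert a (nd l b r) with a ≤? b
... | yes _ = nd (insert a l) b r
... | no  _ = nd l b (insert a r)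

rtree : Word → LTree
rtree = foldr insert lf

Sh : LTree → BTree
Sh lf = leaf
Sh (nd l _ r) = node (Sh l) (Sh r)

-- Sylvester congruence.  Elements of sylv are represented by words,
-- with equality of elements being ≡sylv; the product is concatenation.
_≡sylv_ : Word → Word → Set
u ≡sylv v = rtree u ≡ rtree v

P : Word → LTree
P = rtree

Good : BTree → BTree → Word → Word × Word → Set
Good U V w (u , v) = ((u ++ v) ≡sylv w) × (Sh (P u) ≡ U) × (Sh (P v) ≡ V)

_≈pair_ : Word × Word → Word × Word → Set
(u , v) ≈pair (u' , v') = (u ≡sylv u') × (v ≡sylv v')

HasCount : BTree → BTree → Word → ℕ → Set
HasCount U V w n =
  Σ (Fin n → Word × Word) λ f →
    ((i : Fin n) → Good U V w (f i)) ×
    ((i j : Fin n) → f i ≈pair f j → i ≡ j) ×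
    ((p : Word × Word) → Good U V w p → ∃ λ i → f i ≈pair p)

-- Inserting the letters of u into rtree v sends each of them down the search tree, so
-- rtree (u v) = merge (rtree u) (rtree v): the root of rtree v stays in place, and rtree u is
-- cut by its label into the part ≤ it and the part > it, which are merged recursively into the
-- two subtrees.  Factorisations w = s t with Sh P(s) = U, Sh P(t) = V therefore correspond to
-- pairs of search trees A, B of shapes U, V with merge A B = P(w).  When P(w′) has the same
-- shape, such a pair is transferred along the shape: B is relabelled by the nodes of P(w′) it
-- occupies, and A by recursively transferring its two parts and reassembling them under the
-- new labels.  Transferring back from P(w′) to P(w) undoes this, so the two sets of
-- factorisations are in bijection.
module Submission where

open import Defs
open import Data.Nat using (ℕ; _≤_; _<_; _≤?_)
open import Data.Nat.Properties using (≤-trans; <⇒≤; <⇒≱; ≰⇒>; ≤-<-trans)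
open import Data.List using ([]; _∷_; _++_)
open import Data.Product using (_×_; _,_; proj₁; proj₂; ∃)
open import Relation.Nullary using (yes; no; ¬_)
open import Relation.Nullary.Negation using (contradiction)
open import Relation.Binary.PropositionalEquality

data All (Q : Letter → Set) : LTree → Set where
  lf : All Q lf
  nd : ∀ {l x r} → All Q l → Q x → All Q r → All Q (nd l x r)

data BST : LTree → Set where
  lf : BST lf
  nd : ∀ {l x r} → BST l → BST r → All (_≤ x) l → All (x <_) r → BST (nd l x r)

All-map : ∀ {Q R : Letter → Set} → (∀ {z} → Q z → R z) → ∀ {t} → All Q t → All R t
All-map f lf = lf
All-map f (nd al q ar) = nd (All-map f al) (f q) (All-map f ar)

lower upper : Letter → LTree → LTree
lower a lf = lf
lower a (nd l x r) with x ≤? a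
... | yes _ = nd l x (lower a r)
... | no _ = lower a l
upper a lf = lf
upper a (nd l x r) with x ≤? a
... | yes _ = upper a r
... | no _ = nd (upper a l) x r

merge : LTree → LTree → LTree
merge A lf = A
merge A (nd Bl b Br) = nd (merge (lower b A) Bl) b (merge (upper b A) Br)

insert-≤ : ∀ {c l x r} → c ≤ x → insert c (nd l x r) ≡ nd (insert c l) x r
insert-≤ {c} {x = x} c≤x with c ≤? x
... | yes _ = refl
... | no c≰x = contradiction c≤x c≰x

insert-≰ : ∀ {c l x r} → ¬ c ≤ x → insert c (nd l x r) ≡ nd l x (insert c r)
insert-≰ {c} {x = x} c≰x with c ≤? x
... | yes c≤x = contradiction c≤x c≰x
... | no _ = refl

lower-≤ : ∀ {a l x r} → x ≤ a → lower a (nd l x r) ≡ nd l x (lower a r)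
lower-≤ {a} {x = x} x≤a with x ≤? a
... | yes _ = refl
... | no x≰a = contradiction x≤a x≰a

lower-≰ : ∀ {a l x r} → ¬ x ≤ a → lower a (nd l x r) ≡ lower a l
lower-≰ {a} {x = x} x≰a with x ≤? a
... | yes x≤a = contradiction x≤a x≰a
... | no _ = refl

upper-≤ : ∀ {a l x r} → x ≤ a → upper a (nd l x r) ≡ upper a r
upper-≤ {a} {x = x} x≤a with x ≤? a
... | yes _ = refl
... | no x≰a = contradiction x≤a x≰a

upper-≰ : ∀ {a l x r} → ¬ x ≤ a → upper a (nd l x r) ≡ nd (upper a l) x r
upper-≰ {a} {x = x} x≰a with x ≤? a
... | yes x≤a = contradiction x≤a x≰a
... | no _ = refl

lower-insert-≤ : ∀ {a c} A → c ≤ a → lower a (insert c A) ≡ insert c (lower a A)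
lower-insert-≤ lf c≤a = lower-≤ c≤a
lower-insert-≤ {a} {c} (nd l x r) c≤a with c ≤? x | x ≤? a
... | yes c≤x | yes x≤a rewrite lower-≤ {l = insert c l} {r = r} x≤a = sym (insert-≤ c≤x)
... | yes _   | no x≰a  rewrite lower-≰ {l = insert c l} {r = r} x≰a = lower-insert-≤ l c≤a
... | no c≰x  | yes x≤a rewrite lower-≤ {l = l} {r = insert c r} x≤a | lower-insert-≤ r c≤a = sym (insert-≰ c≰x)
... | no c≰x  | no x≰a  = contradiction (≤-trans (<⇒≤ (≰⇒> c≰x)) c≤a) x≰a

lower-insert-≰ : ∀ {a c} A → ¬ c ≤ a → lower a (insert c A) ≡ lower a A
lower-insert-≰ lf c≰a = lower-≰ c≰a
lower-insert-≰ {a} {c} (nd l x r) c≰a with c ≤? x | x ≤? a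
... | yes c≤x | yes x≤a = contradiction (≤-trans c≤x x≤a) c≰a
... | yes _   | no x≰a  rewrite lower-≰ {l = insert c l} {r = r} x≰a = lower-insert-≰ l c≰a
... | no _    | yes x≤a rewrite lower-≤ {l = l} {r = insert c r} x≤a | lower-insert-≰ r c≰a = refl
... | no _    | no x≰a  rewrite lower-≰ {l = l} {r = insert c r} x≰a = refl

upper-insert-≤ : ∀ {a c} A → c ≤ a → upper a (insert c A) ≡ upper a A
upper-insert-≤ lf c≤a = upper-≤ c≤a
upper-insert-≤ {a} {c} (nd l x r) c≤a with c ≤? x | x ≤? a
... | yes _   | yes x≤a rewrite upper-≤ {l = insert c l} {r = r} x≤a = refl
... | yes _   | no x≰a  rewrite upper-≰ {l = insert c l} {r = r} x≰a | upper-insert-≤ l c≤a = refl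
... | no _    | yes x≤a rewrite upper-≤ {l = l} {r = insert c r} x≤a = upper-insert-≤ r c≤a
... | no c≰x  | no x≰a  = contradiction (≤-trans (<⇒≤ (≰⇒> c≰x)) c≤a) x≰a

upper-insert-≰ : ∀ {a c} A → ¬ c ≤ a → upper a (insert c A) ≡ insert c (upper a A)
upper-insert-≰ lf c≰a = upper-≰ c≰a
upper-insert-≰ {a} {c} (nd l x r) c≰a with c ≤? x | x ≤? a
... | yes c≤x | yes x≤a = contradiction (≤-trans c≤x x≤a) c≰a
... | yes c≤x | no x≰a  rewrite upper-≰ {l = insert c l} {r = r} x≰a | upper-insert-≰ l c≰a = sym (insert-≤ c≤x)
... | no _    | yes x≤a rewrite upper-≤ {l = l} {r = insert c r} x≤a = upper-insert-≰ r c≰a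
... | no c≰x  | no x≰a  rewrite upper-≰ {l = l} {r = insert c r} x≰a = sym (insert-≰ c≰x)

merge-identityˡ : ∀ B → merge lf B ≡ B
merge-identityˡ lf = refl
merge-identityˡ (nd l x r) = cong₂ (λ l′ r′ → nd l′ x r′) (merge-identityˡ l) (merge-identityˡ r)

insert-merge : ∀ c A B → insert c (merge A B) ≡ merge (insert c A) B
insert-merge c A lf = refl
insert-merge c A (nd Bl b Br) with c ≤? b
... | yes c≤b rewrite lower-insert-≤ A c≤b | upper-insert-≤ A c≤b | insert-merge c (lower b A) Bl = refl
... | no c≰b rewrite lower-insert-≰ A c≰b | upper-insert-≰ A c≰b | insert-merge c (upper b A) Br = refl

rtree-++ : ∀ u v → rtree (u ++ v) ≡ merge (rtree u) (rtree v)
rtree-++ [] v = sym (merge-identityˡ (rtree v))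
rtree-++ (c ∷ u) v = trans (cong (insert c) (rtree-++ u v)) (insert-merge c (rtree u) (rtree v))

All-insert : ∀ {Q : Letter → Set} {c} A → Q c → All Q A → All Q (insert c A)
All-insert lf qc lf = nd lf qc lf
All-insert {c = c} (nd l x r) qc (nd al qx ar) with c ≤? x
... | yes _ = nd (All-insert l qc al) qx ar
... | no _ = nd al qx (All-insert r qc ar)

BST-insert : ∀ {c} A → BST A → BST (insert c A)
BST-insert lf lf = nd lf lf lf lf
BST-insert {c} (nd l x r) (nd bl br al ar) with c ≤? x
... | yes c≤x = nd (BST-insert l bl) br (All-insert l c≤x al) ar
... | no c≰x = nd bl (BST-insert r br) al (All-insert r (≰⇒> c≰x) ar)

BST-rtree : ∀ u → BST (rtree u)
BST-rtree [] = lf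
BST-rtree (c ∷ u) = BST-insert (rtree u) (BST-rtree u)

lower-all≤ : ∀ {a} A → All (_≤ a) A → lower a A ≡ A
lower-all≤ lf lf = refl
lower-all≤ (nd l x r) (nd _ x≤a ar) rewrite lower-≤ {l = l} {r = r} x≤a | lower-all≤ r ar = refl

upper-all≤ : ∀ {a} A → All (_≤ a) A → upper a A ≡ lf
upper-all≤ lf lf = refl
upper-all≤ (nd l x r) (nd _ x≤a ar) rewrite upper-≤ {l = l} {r = r} x≤a = upper-all≤ r ar

lower-all> : ∀ {a} A → All (a <_) A → lower a A ≡ lf
lower-all> lf lf = refl
lower-all> (nd l x r) (nd al a<x _) rewrite lower-≰ {l = l} {r = r} (<⇒≱ a<x) = lower-all> l al

upper-all> : ∀ {a} A → All (a <_) A → upper a A ≡ A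
upper-all> lf lf = refl
upper-all> (nd l x r) (nd al a<x _) rewrite upper-≰ {l = l} {r = r} (<⇒≱ a<x) | upper-all> l al = refl

-- Every node comes after its subtrees, so rtree inserts it before them.
read : LTree → Word
read lf = []
read (nd l a r) = read l ++ read r ++ a ∷ []

rtree-read : ∀ A → BST A → rtree (read A) ≡ A
rtree-read lf lf = refl
rtree-read (nd l a r) (nd bl br al ar)
  rewrite rtree-++ (read l) (read r ++ a ∷ []) | rtree-++ (read r) (a ∷ [])
        | rtree-read l bl | rtree-read r br
        | lower-all> r ar | upper-all> r ar | lower-all≤ l al | upper-all≤ l al
        | merge-identityˡ r = refl

leftSub rightSub : LTree → LTree
leftSub lf = lf
leftSub (nd l _ _) = l
rightSub lf = lf
rightSub (nd _ _ r) = r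

withLeft withRight : LTree → LTree → LTree
withLeft lf _ = lf
withLeft (nd _ x r) l = nd l x r
withRight lf _ = lf
withRight (nd l x _) r = nd l x r

-- When Sh X = Sh (lower a A) and Sh Y = Sh (upper a A), this is the tree of shape Sh A
-- whose nodes cut out by lower a carry the labels of X and the others those of Y.
reassemble : LTree → Letter → LTree → LTree → LTree
reassemble lf a X Y = lf
reassemble (nd l x r) a X Y with x ≤? a
... | yes _ = withRight X (reassemble r a (rightSub X) Y)
... | no _ = withLeft Y (reassemble l a X (leftSub Y))

reassemble-≤ : ∀ {l x r a X Y} → x ≤ a →
  reassemble (nd l x r) a X Y ≡ withRight X (reassemble r a (rightSub X) Y)
reassemble-≤ {x = x} {a = a} x≤a with x ≤? a
... | yes _ = refl
... | no x≰a = contradiction x≤a x≰a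

reassemble-≰ : ∀ {l x r a X Y} → ¬ x ≤ a →
  reassemble (nd l x r) a X Y ≡ withLeft Y (reassemble l a X (leftSub Y))
reassemble-≰ {x = x} {a = a} x≰a with x ≤? a
... | yes x≤a = contradiction x≤a x≰a
... | no _ = refl

node-injectiveˡ : ∀ {s t s′ t′} → node s t ≡ node s′ t′ → s ≡ s′
node-injectiveˡ refl = refl

node-injectiveʳ : ∀ {s t s′ t′} → node s t ≡ node s′ t′ → t ≡ t′
node-injectiveʳ refl = refl

Sh-reassemble : ∀ A a X Y → Sh X ≡ Sh (lower a A) → Sh Y ≡ Sh (upper a A) →
  Sh (reassemble A a X Y) ≡ Sh A
Sh-reassemble lf a X Y _ _ = refl
Sh-reassemble (nd l x r) a X Y shX shY with x ≤? a
Sh-reassemble (nd l x r) a (nd Xl _ Xr) Y shX shY | yes _ =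
  cong₂ node (node-injectiveˡ shX) (Sh-reassemble r a Xr Y (node-injectiveʳ shX) shY)
Sh-reassemble (nd l x r) a X (nd Yl _ Yr) shX shY | no _ =
  cong₂ node (Sh-reassemble l a X Yl shX (node-injectiveˡ shY)) (node-injectiveʳ shY)

record Fits (A : LTree) (a a′ : Letter) (X Y : LTree) : Set where
  constructor fits
  field
    shapeˡ : Sh X ≡ Sh (lower a A)
    shapeʳ : Sh Y ≡ Sh (upper a A)
    boundˡ : All (_≤ a′) X
    boundʳ : All (a′ <_) Y

reassemble-parts : ∀ A a a′ X Y → Fits A a a′ X Y →
  lower a′ (reassemble A a X Y) ≡ X × upper a′ (reassemble A a X Y) ≡ Y
reassemble-parts lf a a′ lf lf _ = refl , refl
reassemble-parts (nd l x r) a a′ X Y (fits shX shY X≤a′ a′<Y) with x ≤? a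
reassemble-parts (nd l x r) a a′ (nd Xl x′ Xr) Y (fits shX shY (nd _ x′≤a′ Xr≤a′) a′<Y) | yes _
  rewrite lower-≤ {l = Xl} {r = reassemble r a Xr Y} x′≤a′
        | upper-≤ {l = Xl} {r = reassemble r a Xr Y} x′≤a′ =
  let (lower≡ , upper≡) = reassemble-parts r a a′ Xr Y (fits (node-injectiveʳ shX) shY Xr≤a′ a′<Y)
  in cong (nd Xl x′) lower≡ , upper≡
reassemble-parts (nd l x r) a a′ X (nd Yl y′ Yr) (fits shX shY X≤a′ (nd a′<Yl a′<y′ _)) | no _
  rewrite lower-≰ {l = reassemble l a X Yl} {r = Yr} (<⇒≱ a′<y′)
        | upper-≰ {l = reassemble l a X Yl} {r = Yr} (<⇒≱ a′<y′) =
  let (lower≡ , upper≡) = reassemble-parts l a a′ X Yl (fits shX (node-injectiveˡ shY) X≤a′ a′<Yl)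
  in lower≡ , cong (λ t → nd t y′ Yr) upper≡

All-reassemble : ∀ {Q : Letter → Set} A a X Y → All Q X → All Q Y → All Q (reassemble A a X Y)
All-reassemble lf a X Y _ _ = lf
All-reassemble (nd l x r) a X Y qX qY with x ≤? a
All-reassemble (nd l x r) a lf Y qX qY | yes _ = lf
All-reassemble (nd l x r) a (nd _ _ Xr) Y (nd qXl qx qXr) qY | yes _ =
  nd qXl qx (All-reassemble r a Xr Y qXr qY)
All-reassemble (nd l x r) a X lf qX qY | no _ = lf
All-reassemble (nd l x r) a X (nd Yl _ _) qX (nd qYl qy qYr) | no _ =
  nd (All-reassemble l a X Yl qX qYl) qy qYr

BST-reassemble : ∀ A a a′ X Y → BST X → BST Y → All (_≤ a′) X → All (a′ <_) Y →
  BST (reassemble A a X Y)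
BST-reassemble lf a a′ X Y _ _ _ _ = lf
BST-reassemble (nd l x r) a a′ X Y bX bY X≤a′ a′<Y with x ≤? a
BST-reassemble (nd l x r) a a′ lf Y bX bY X≤a′ a′<Y | yes _ = lf
BST-reassemble (nd l x r) a a′ (nd Xl x′ Xr) Y (nd bXl bXr Xl≤x′ x′<Xr) bY (nd _ x′≤a′ Xr≤a′) a′<Y | yes _ =
  nd bXl (BST-reassemble r a a′ Xr Y bXr bY Xr≤a′ a′<Y) Xl≤x′
     (All-reassemble r a Xr Y x′<Xr (All-map (≤-<-trans x′≤a′) a′<Y))
BST-reassemble (nd l x r) a a′ X lf bX bY X≤a′ a′<Y | no _ = lf
BST-reassemble (nd l x r) a a′ X (nd Yl y′ Yr) bX (nd bYl bYr Yl≤y′ y′<Yr) X≤a′ (nd a′<Yl a′<y′ _) | no _ =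
  nd (BST-reassemble l a a′ X Yl bX bYl X≤a′ a′<Yl) bYr
     (All-reassemble l a X Yl (All-map (λ z≤a′ → ≤-trans z≤a′ (<⇒≤ a′<y′)) X≤a′) Yl≤y′) y′<Yr

reassemble-reassemble : ∀ A a a′ X Y → Fits A a a′ X Y →
  reassemble (reassemble A a X Y) a′ (lower a A) (upper a A) ≡ A
reassemble-reassemble lf a a′ X Y _ = refl
reassemble-reassemble (nd l x r) a a′ X Y (fits shX shY X≤a′ a′<Y) with x ≤? a
reassemble-reassemble (nd l x r) a a′ (nd Xl x′ Xr) Y (fits shX shY (nd _ x′≤a′ Xr≤a′) a′<Y) | yes _
  rewrite reassemble-≤ {Xl} {x′} {reassemble r a Xr Y} {a′} {nd l x (lower a r)} {upper a r} x′≤a′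
        | reassemble-reassemble r a a′ Xr Y (fits (node-injectiveʳ shX) shY Xr≤a′ a′<Y) = refl
reassemble-reassemble (nd l x r) a a′ X (nd Yl y′ Yr) (fits shX shY X≤a′ (nd a′<Yl a′<y′ _)) | no _
  rewrite reassemble-≰ {reassemble l a X Yl} {y′} {Yr} {a′} {lower a l} {nd (upper a l) x r} (<⇒≱ a′<y′)
        | reassemble-reassemble l a a′ X Yl (fits shX (node-injectiveˡ shY) X≤a′ a′<Yl) = refl

All-lower-upper : ∀ {Q : Letter → Set} a A → All Q (lower a A) → All Q (upper a A) → All Q A
All-lower-upper a lf _ _ = lf
All-lower-upper a (nd l x r) qL qU with x ≤? a
All-lower-upper a (nd l x r) (nd ql qx qLr) qU | yes _ = nd ql qx (All-lower-upper a r qLr qU)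
All-lower-upper a (nd l x r) qL (nd qUl qx qr) | no _ = nd (All-lower-upper a l qL qUl) qx qr

All-merge : ∀ {Q : Letter → Set} A B → All Q (merge A B) → All Q A × All Q B
All-merge A lf qA = qA , lf
All-merge A (nd Bl b Br) (nd ql qb qr) =
  let (qAl , qBl) = All-merge (lower b A) Bl ql
      (qAr , qBr) = All-merge (upper b A) Br qr
  in All-lower-upper b A qAl qAr , nd qBl qb qBr

record Factorises (L A B : LTree) : Set where
  constructor factorises
  field
    bstˡ : BST A
    bstʳ : BST B
    merge≡ : merge A B ≡ L

All-factors : ∀ {Q : Letter → Set} {L A B} → Factorises L A B → All Q L → All Q A × All Q B
All-factors (factorises _ _ refl) = All-merge _ _

transfer : LTree → LTree → LTree → LTree × LTree
transfer L′ A lf = L′ , lf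
transfer (nd Ll′ a′ Lr′) A (nd Bl b Br) =
  let (X , Bl′) = transfer Ll′ (lower b A) Bl
      (Y , Br′) = transfer Lr′ (upper b A) Br
  in reassemble A b X Y , nd Bl′ a′ Br′
transfer lf A (nd _ _ _) = lf , lf  -- unreachable when Sh (merge A B) ≡ Sh L′

transfer-shapes : ∀ L′ A B → Sh (merge A B) ≡ Sh L′ →
  Sh (proj₁ (transfer L′ A B)) ≡ Sh A × Sh (proj₂ (transfer L′ A B)) ≡ Sh B
transfer-shapes L′ A lf sh = sym sh , refl
transfer-shapes (nd Ll′ a′ Lr′) A (nd Bl b Br) sh =
  let (shX , shBl′) = transfer-shapes Ll′ (lower b A) Bl (node-injectiveˡ sh)
      (shY , shBr′) = transfer-shapes Lr′ (upper b A) Br (node-injectiveʳ sh)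
  in Sh-reassemble A b _ _ shX shY , cong₂ node shBl′ shBr′

transfer-factorises : ∀ L′ A B → BST L′ → Sh (merge A B) ≡ Sh L′ →
  Factorises L′ (proj₁ (transfer L′ A B)) (proj₂ (transfer L′ A B))

transfer-fits : ∀ Ll′ a′ Lr′ A b Bl Br → BST (nd Ll′ a′ Lr′) →
  Sh (merge A (nd Bl b Br)) ≡ Sh (nd Ll′ a′ Lr′) →
  Fits A b a′ (proj₁ (transfer Ll′ (lower b A) Bl)) (proj₁ (transfer Lr′ (upper b A) Br))
transfer-fits Ll′ a′ Lr′ A b Bl Br (nd bstl bstr l≤a′ a′<r) sh =
  fits (proj₁ (transfer-shapes Ll′ (lower b A) Bl (node-injectiveˡ sh)))
       (proj₁ (transfer-shapes Lr′ (upper b A) Br (node-injectiveʳ sh)))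
       (proj₁ (All-factors (transfer-factorises Ll′ (lower b A) Bl bstl (node-injectiveˡ sh)) l≤a′))
       (proj₁ (All-factors (transfer-factorises Lr′ (upper b A) Br bstr (node-injectiveʳ sh)) a′<r))

transfer-factorises L′ A lf bstL′ sh = factorises bstL′ lf refl
transfer-factorises (nd Ll′ a′ Lr′) A (nd Bl b Br) bst@(nd bstl bstr l≤a′ a′<r) sh =
  let Fˡ = transfer-factorises Ll′ (lower b A) Bl bstl (node-injectiveˡ sh)
      Fʳ = transfer-factorises Lr′ (upper b A) Br bstr (node-injectiveʳ sh)
      φ = transfer-fits Ll′ a′ Lr′ A b Bl Br bst sh
      (lower≡ , upper≡) = reassemble-parts A b a′ _ _ φ
  in factorises (BST-reassemble A b a′ _ _ (bstˡ Fˡ) (bstˡ Fʳ) (boundˡ φ) (boundʳ φ))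
                (nd (bstʳ Fˡ) (bstʳ Fʳ) (proj₂ (All-factors Fˡ l≤a′)) (proj₂ (All-factors Fʳ a′<r)))
                (cong₂ (λ l r → nd l a′ r)
                       (trans (cong (λ Z → merge Z _) lower≡) (merge≡ Fˡ))
                       (trans (cong (λ Z → merge Z _) upper≡) (merge≡ Fʳ)))
  where open Factorises
        open Fits

transfer-inverse : ∀ L′ A B → BST L′ → Sh (merge A B) ≡ Sh L′ →
  transfer (merge A B) (proj₁ (transfer L′ A B)) (proj₂ (transfer L′ A B)) ≡ (A , B)
transfer-inverse L′ A lf bstL′ sh = refl
transfer-inverse (nd Ll′ a′ Lr′) A (nd Bl b Br) bst@(nd bstl bstr _ _) sh =
  begin
    (reassemble A′ a′ (proj₁ Pˡ) (proj₁ Pʳ) , nd (proj₂ Pˡ) b (proj₂ Pʳ))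
  ≡⟨ cong₂ (λ P Q → reassemble A′ a′ (proj₁ P) (proj₁ Q) , nd (proj₂ P) b (proj₂ Q)) invˡ invʳ ⟩
    (reassemble A′ a′ (lower b A) (upper b A) , nd Bl b Br)
  ≡⟨ cong (_, nd Bl b Br) (reassemble-reassemble A b a′ X Y φ) ⟩
    (A , nd Bl b Br)
  ∎
  where
  open ≡-Reasoning
  X = proj₁ (transfer Ll′ (lower b A) Bl)
  Y = proj₁ (transfer Lr′ (upper b A) Br)
  A′ = reassemble A b X Y
  φ = transfer-fits Ll′ a′ Lr′ A b Bl Br bst sh
  Pˡ = transfer (merge (lower b A) Bl) (lower a′ A′) (proj₂ (transfer Ll′ (lower b A) Bl))
  Pʳ = transfer (merge (upper b A) Br) (upper a′ A′) (proj₂ (transfer Lr′ (upper b A) Br))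
  invˡ : Pˡ ≡ (lower b A , Bl)
  invˡ = trans (cong (λ Z → transfer _ Z _) (proj₁ (reassemble-parts A b a′ X Y φ)))
               (transfer-inverse Ll′ (lower b A) Bl bstl (node-injectiveˡ sh))
  invʳ : Pʳ ≡ (upper b A , Br)
  invʳ = trans (cong (λ Z → transfer _ Z _) (proj₂ (reassemble-parts A b a′ X Y φ)))
               (transfer-inverse Lr′ (upper b A) Br bstr (node-injectiveʳ sh))

≈pair-sym : ∀ p q → p ≈pair q → q ≈pair p
≈pair-sym _ _ (e₁ , e₂) = sym e₁ , sym e₂

≈pair-trans : ∀ p q r → p ≈pair q → q ≈pair r → p ≈pair r
≈pair-trans _ _ _ (e₁ , e₂) (f₁ , f₂) = trans e₁ f₁ , trans e₂ f₂

HasCount-transport : ∀ {U V w U′ V′ w′} n (Φ Ψ : Word × Word → Word × Word) →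
  (∀ p → Good U V w p → Good U′ V′ w′ (Φ p)) →
  (∀ q → Good U′ V′ w′ q → Good U V w (Ψ q)) →
  (∀ p q → p ≈pair q → Φ p ≈pair Φ q) →
  (∀ p q → p ≈pair q → Ψ p ≈pair Ψ q) →
  (∀ p → Good U V w p → Ψ (Φ p) ≈pair p) →
  (∀ q → Good U′ V′ w′ q → Φ (Ψ q) ≈pair q) →
  HasCount U V w n → HasCount U′ V′ w′ n
HasCount-transport {U′ = U′} {V′} {w′} n Φ Ψ goodΦ goodΨ congΦ congΨ ΨΦ ΦΨ (f , good , injective , surjective) =
  (λ i → Φ (f i)) , (λ i → goodΦ (f i) (good i)) , injective′ , surjective′
  where
  injective′ : ∀ i j → Φ (f i) ≈pair Φ (f j) → i ≡ j
  injective′ i j Φfi≈Φfj = injective i j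
    (≈pair-trans (f i) (Ψ (Φ (f i))) (f j)
      (≈pair-sym (Ψ (Φ (f i))) (f i) (ΨΦ (f i) (good i)))
      (≈pair-trans (Ψ (Φ (f i))) (Ψ (Φ (f j))) (f j)
        (congΨ (Φ (f i)) (Φ (f j)) Φfi≈Φfj) (ΨΦ (f j) (good j))))
  surjective′ : ∀ q → Good U′ V′ w′ q → ∃ λ i → Φ (f i) ≈pair q
  surjective′ q good′ =
    let (i , fi≈Ψq) = surjective (Ψ q) (goodΨ q good′)
    in i , ≈pair-trans (Φ (f i)) (Φ (Ψ q)) q (congΦ (f i) (Ψ q) fi≈Ψq) (ΦΨ q good′)

transferWords : LTree → Word × Word → Word × Word
transferWords L′ (u , v) =
  let (A′ , B′) = transfer L′ (rtree u) (rtree v) in read A′ , read B′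

transferWords-cong : ∀ L′ p q → p ≈pair q → transferWords L′ p ≈pair transferWords L′ q
transferWords-cong L′ _ _ (eu , ev) =
  let e = cong₂ (transfer L′) eu ev
  in cong (λ P → rtree (read (proj₁ P))) e , cong (λ P → rtree (read (proj₂ P))) e

Good-factorises : ∀ {U V w u v} → Good U V w (u , v) → Factorises (rtree w) (rtree u) (rtree v)
Good-factorises {u = u} {v} (uv≡w , _ , _) =
  factorises (BST-rtree u) (BST-rtree v) (trans (sym (rtree-++ u v)) uv≡w)

module _ {U V : BTree} (w w′ : Word) (sh : Sh (rtree w) ≡ Sh (rtree w′)) (u v : Word)
         (good : Good U V w (u , v)) where

  private
    A′ = proj₁ (transfer (rtree w′) (rtree u) (rtree v))
    B′ = proj₂ (transfer (rtree w′) (rtree u) (rtree v))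
    uv≡w = Factorises.merge≡ (Good-factorises {w = w} {u} {v} good)
    sh′ = trans (cong Sh uv≡w) sh
    F = transfer-factorises (rtree w′) (rtree u) (rtree v) (BST-rtree w′) sh′
    readA′ = rtree-read A′ (Factorises.bstˡ F)
    readB′ = rtree-read B′ (Factorises.bstʳ F)

  Good-transfer : Good U V w′ (transferWords (rtree w′) (u , v))
  Good-transfer =
    trans (rtree-++ (read A′) (read B′)) (trans (cong₂ merge readA′ readB′) (Factorises.merge≡ F)) ,
    trans (cong Sh readA′) (trans (proj₁ (transfer-shapes (rtree w′) (rtree u) (rtree v) sh′)) (proj₁ (proj₂ good))) ,
    trans (cong Sh readB′) (trans (proj₂ (transfer-shapes (rtree w′) (rtree u) (rtree v) sh′)) (proj₂ (proj₂ good)))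

  transferWords-inverse : transferWords (rtree w) (transferWords (rtree w′) (u , v)) ≈pair (u , v)
  transferWords-inverse =
    trans (cong (λ P → rtree (read (proj₁ P))) inverse) (rtree-read (rtree u) (BST-rtree u)) ,
    trans (cong (λ P → rtree (read (proj₂ P))) inverse) (rtree-read (rtree v) (BST-rtree v))
    where
    inverse : transfer (rtree w) (rtree (read A′)) (rtree (read B′)) ≡ (rtree u , rtree v)
    inverse = trans (cong₂ (transfer (rtree w)) readA′ readB′)
                    (trans (cong (λ L → transfer L A′ B′) (sym uv≡w))
                           (transfer-inverse (rtree w′) (rtree u) (rtree v) (BST-rtree w′) sh′))

theorem3 : (T U V : BTree) (w w' : Word) (n : ℕ) →
    Sh (P w) ≡ T → Sh (P w') ≡ T →
    HasCount U V w n → HasCount U V w' n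
theorem3 T U V w w' n shw shw' =
  HasCount-transport {U} {V} {w} {U} {V} {w'} n (transferWords (rtree w')) (transferWords (rtree w))
    (λ (u , v) → Good-transfer w w' sh u v) (λ (u , v) → Good-transfer w' w (sym sh) u v)
    (transferWords-cong (rtree w')) (transferWords-cong (rtree w))
    (λ (u , v) → transferWords-inverse w w' sh u v) (λ (u , v) → transferWords-inverse w' w (sym sh) u v)
  where
  sh : Sh (rtree w) ≡ Sh (rtree w')
  sh = trans shw (sym shw')
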